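{- For any fixed $T\in\mathbb{N}_{>0}$ and $m\in\mathbb{N}_{>0}$, the decision problem FireFightingInTime restricted to instances with these values of $T$ and $m$ is solvable in polynomial time.
   Context: All graphs are finite, simple and undirected. For a graph $G=(V,E)$ and $W\subseteq V$, $N(W)$ is the set of nodes in $V\setminus W$ adjacent to at least one node of $W$. For $m\in\mathbb{N}_{>0}$, an $m$-strategy of length $T$ is a sequence $(F_1,\dots,F_T)$ of subsets of $V$ with $|F_i|\le m$. Its burning sets are $B_0=V$ and $B_t=(B_{t-1}\setminus F_t)\cup N(B_{t-1}\setminus F_t)$ for $t\ge1$, where $F_t=\emptyset$ for $t>T$. The strategy is winning if $B_T=\emptyset$. FireFightingInTime: given $G$, $m$ and $T$, decide whether there is a winning $m$-strategy for $G$ of length $T$. -}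

module Defs where

open import Data.Nat using (ℕ; zero; suc; _+_; _*_; _^_; _≤_; _<_)
open import Data.Bool using (Bool; true; false; not; _∧_)
open import Data.Fin using (Fin)
open import Data.Fin.Subset using (Subset; ⊥; _∪_; _─_; ∣_∣)
open import Data.Vec using (Vec; []; _∷_; lookup; tabulate)
open import Data.List using (List; []; _∷_; _++_; replicate; concatMap; allFin; length)
open import Data.Bool.ListAction using (any)
open import Data.Product using (Σ; _×_; _,_; ∃)
open import Relation.Binary.PropositionalEquality using (_≡_)

record Graph (n : ℕ) : Set where
  field
    adj    : Fin n → Fin n → Bool
    sym    : ∀ i j → adj i j ≡ adj j i
    irrefl : ∀ i → adj i i ≡ false
open Graph public

N : ∀ {n} → Graph n → Subset n → Subset n
N {n} G W = tabulate λ v →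
  not (lookup W v) ∧ any (λ w → lookup W w ∧ adj G w v) (allFin n)

burnStep : ∀ {n} → Graph n → Subset n → Subset n → Subset n
burnStep G B F = (B ─ F) ∪ N G (B ─ F)

burnFrom : ∀ {n T} → Graph n → Subset n → Vec (Subset n) T → Subset n
burnFrom G B []       = B
burnFrom G B (F ∷ Fs) = burnFrom G (burnStep G B F) Fs

V : ∀ n → Subset n
V n = tabulate λ _ → true

AllSize≤ : ∀ {n T} → ℕ → Vec (Subset n) T → Set
AllSize≤ m []       = Data.Unit.⊤ where import Data.Unit
AllSize≤ m (F ∷ Fs) = ∣ F ∣ ≤ m × AllSize≤ m Fs

Winning : ∀ {n T} → Graph n → ℕ → Vec (Subset n) T → Set
Winning {n} G m Fs = AllSize≤ m Fs × burnFrom G (V n) Fs ≡ ⊥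

FireFightingInTime : ∀ {n} → Graph n → ℕ → ℕ → Set
FireFightingInTime {n} G m T = Σ (Vec (Subset n) T) λ Fs → Winning G m Fs

data Sym : Set where
  s0 s1 blank : Sym

data Move : Set where
  L R : Move

data Action (q : ℕ) : Set where
  halt  : Bool → Action q                  -- halt, accept (true) / reject (false)
  write : Fin q → Sym → Move → Action q

record TM : Set where
  field
    states : ℕ
    start  : Fin states
    δ      : Fin states → Sym → Action states
open TM public

-- configuration: state, reversed left part, head symbol, right part
record Config (M : TM) : Set where
  constructor conf
  field
    state : Fin (states M)
    left  : List Sym
    head  : Sym
    right : List Sym

data Result (M : TM) : Set where
  halted  : Bool → Result M
  running : Config M → Result M

private
  headOf : List Sym → Sym
  headOf []      = blank
  headOf (x ∷ _) = x
  tailOf : List Sym → List Sym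
  tailOf []       = []
  tailOf (_ ∷ xs) = xs

step : (M : TM) → Config M → Result M
step M (conf q l h r) with δ M q h
... | halt b = halted b
... | write q' s L = running (conf q' (tailOf l) (headOf l) (s ∷ r))
... | write q' s R = running (conf q' (s ∷ l) (headOf r) (tailOf r))

run : (M : TM) → ℕ → Config M → Result M
run M zero c = running c
run M (suc k) c with step M c
... | halted b   = halted b
... | running c' = run M k c'

initConf : (M : TM) → List Sym → Config M
initConf M []       = conf (start M) [] blank []
initConf M (x ∷ xs) = conf (start M) [] x xs

bit : Bool → Sym
bit true  = s1
bit false = s0

encode : ∀ {n} → Graph n → List Sym
encode {n} G = replicate n s1 ++ (s0 ∷
  concatMap (λ i → concatMap (λ j → bit (adj G i j) ∷ []) (allFin n)) (allFin n))

PolyTimeDecides : TM → (∀ {n} → Graph n → Set) → Set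
PolyTimeDecides M P =
  Σ ℕ λ c → Σ ℕ λ k → ∀ n (G : Graph n) →
    Σ ℕ λ t → Σ Bool λ b →
      t ≤ c * (suc (length (encode G))) ^ k ×
      run M t (initConf M (encode G)) ≡ halted b ×
      (b ≡ true → P G) × (P G → b ≡ true)

{-# OPTIONS --safe #-}
-- A vertex that is never defended keeps burning, so a winning m-strategy of length T
-- defends every vertex at least once and yes-instances have at most K = T m vertices.
-- The unary header of the encoding reveals whether n ≤ K from its first K + 1 cells, and
-- then the whole graph fits into the first 1 + K + K² cells. The answer is therefore a
-- function of a bounded prefix of the tape (computed by exhaustive search over strategies),
-- and every such function is computed, in a constant number of steps, by a machine whose
-- states form a ternary decision tree over the symbols read.
module Submission where

open import Defs
open import Data.Bool using (Bool; true; false; not; _∧_)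
import Data.Bool as Bool
open import Data.Bool.Properties using (∧-comm; ∧-idem)
import Data.Bool.ListAction as Bool
open import Data.Empty using (⊥-elim)
open import Data.Fin as Fin using (Fin; toℕ; combine; remQuot)
open import Data.Fin.Patterns using (0F; 1F; 2F)
open import Data.Fin.Properties using (toℕ<n; toℕ-↑ˡ; toℕ-↑ʳ; remQuot-combine)
open import Data.Fin.Subset using (Subset; ⊥; ⊤; ⋃; _∈_; _∉_; _∪_; _─_; ∣_∣)
open import Data.Fin.Subset.Properties
  using (_∈?_; anySubset?; ∉⊥; ∣⊥∣≡0; ∣⊤∣≡n; p⊆q⇒∣p∣≤∣q∣; p⊆p∪q; x∈p∪q⁺; x∈p∧x∉q⇒x∈p─q)
open import Data.List as List using (List; []; _∷_; _++_; concatMap; allFin; length; replicate)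
open import Data.List.Properties using (map-cong)
open import Data.Nat using (ℕ; zero; suc; _+_; _*_; _⊓_; _≤_; _<_; z≤n; s≤s; _≤?_)
open import Data.Nat.Properties
open import Data.Product using (Σ; _×_; _,_)
open import Data.Sum using (inj₁; inj₂)
open import Data.Unit using (tt)
open import Data.Vec using (Vec; []; _∷_; lookup; toList)
open import Data.Vec.Properties using (≡-dec; tabulate-cong; lookup∘tabulate; lookup⇒[]=)
open import Function using (_∘_; id; mk⇔)
open import Relation.Nullary using (Dec; yes; no; ¬_; does)
open import Relation.Nullary.Decidable using (_×-dec_; dec-true; dec-false; does-⇔)
import Relation.Binary.PropositionalEquality as ≡
open ≡ using (_≡_; refl; cong; cong₂; trans; subst)

Extinguishable : ∀ {n} → Graph n → ℕ → ℕ → Subset n → Set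
Extinguishable {n} G m T B =
  Σ (Vec (Subset n) T) λ Fs → AllSize≤ m Fs × burnFrom G B Fs ≡ ⊥

extinguishable? : ∀ {n} (G : Graph n) m T B → Dec (Extinguishable G m T B)
extinguishable? G m zero B with ≡-dec Bool._≟_ B ⊥
... | yes B≡⊥ = yes ([] , tt , B≡⊥)
... | no B≢⊥ = no λ { ([] , _ , B≡⊥) → B≢⊥ B≡⊥ }
extinguishable? G m (suc T) B
  with anySubset? (λ F → (∣ F ∣ ≤? m) ×-dec extinguishable? G m T (burnStep G B F))
... | yes (F , ∣F∣≤m , Fs , sizes , burnt) = yes (F ∷ Fs , (∣F∣≤m , sizes) , burnt)
... | no none =
  no λ { (F ∷ Fs , (∣F∣≤m , sizes) , burnt) → none (F , ∣F∣≤m , Fs , sizes , burnt) }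

fireFightingInTime? : ∀ {n} (G : Graph n) m T → Dec (FireFightingInTime G m T)
fireFightingInTime? {n} G m T = extinguishable? G m T (V n)

module _ {n} {G H : Graph n} (adj≗ : ∀ i j → adj G i j ≡ adj H i j) where

  N-cong : ∀ W → N G W ≡ N H W
  N-cong W = tabulate-cong λ v → cong (not (lookup W v) ∧_)
    (cong Bool.or (map-cong (λ w → cong (lookup W w ∧_) (adj≗ w v)) (allFin n)))

  burnFrom-cong : ∀ {T} B (Fs : Vec (Subset n) T) → burnFrom G B Fs ≡ burnFrom H B Fs
  burnFrom-cong B []       = refl
  burnFrom-cong B (F ∷ Fs) = trans (burnFrom-cong (burnStep G B F) Fs)
    (cong (λ B′ → burnFrom H B′ Fs) (cong ((B ─ F) ∪_) (N-cong (B ─ F))))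

  fireFightingInTime-cong : ∀ {m T} → FireFightingInTime G m T → FireFightingInTime H m T
  fireFightingInTime-cong (Fs , sizes , burnt) =
    Fs , sizes , trans (≡.sym (burnFrom-cong (V n) Fs)) burnt

-- Yes-instances are small

∣p∪q∣≤∣p∣+∣q∣ : ∀ {n} (p q : Subset n) → ∣ p ∪ q ∣ ≤ ∣ p ∣ + ∣ q ∣
∣p∪q∣≤∣p∣+∣q∣ []          []          = z≤n
∣p∪q∣≤∣p∣+∣q∣ (true ∷ p)  (true ∷ q)  =
  s≤s (≤-trans (∣p∪q∣≤∣p∣+∣q∣ p q) (+-monoʳ-≤ ∣ p ∣ (n≤1+n ∣ q ∣)))
∣p∪q∣≤∣p∣+∣q∣ (true ∷ p)  (false ∷ q) = s≤s (∣p∪q∣≤∣p∣+∣q∣ p q)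
∣p∪q∣≤∣p∣+∣q∣ (false ∷ p) (true ∷ q)  =
  ≤-trans (s≤s (∣p∪q∣≤∣p∣+∣q∣ p q)) (≤-reflexive (≡.sym (+-suc ∣ p ∣ ∣ q ∣)))
∣p∪q∣≤∣p∣+∣q∣ (false ∷ p) (false ∷ q) = ∣p∪q∣≤∣p∣+∣q∣ p q

defended : ∀ {n T} → Vec (Subset n) T → Subset n
defended Fs = ⋃ (toList Fs)

∣defended∣≤T*m : ∀ {n T} m (Fs : Vec (Subset n) T) → AllSize≤ m Fs → ∣ defended Fs ∣ ≤ T * m
∣defended∣≤T*m {n} m []       _               = ≤-reflexive (∣⊥∣≡0 n)
∣defended∣≤T*m     m (F ∷ Fs) (∣F∣≤m , sizes) =
  ≤-trans (∣p∪q∣≤∣p∣+∣q∣ F (defended Fs)) (+-mono-≤ ∣F∣≤m (∣defended∣≤T*m m Fs sizes))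

undefended-keeps-burning : ∀ {n T} (G : Graph n) (Fs : Vec (Subset n) T) {B x} →
  x ∈ B → x ∉ defended Fs → x ∈ burnFrom G B Fs
undefended-keeps-burning G []       x∈B _ = x∈B
undefended-keeps-burning G (F ∷ Fs) x∈B x∉ = undefended-keeps-burning G Fs
  (p⊆p∪q _ (x∈p∧x∉q⇒x∈p─q x∈B (x∉ ∘ x∈p∪q⁺ ∘ inj₁))) (x∉ ∘ x∈p∪q⁺ ∘ inj₂)

x∈V : ∀ n x → x ∈ V n
x∈V n x = lookup⇒[]= x (V n) (lookup∘tabulate _ x)

extinguished⇒defended : ∀ {n T} (G : Graph n) (Fs : Vec (Subset n) T) →
  burnFrom G (V n) Fs ≡ ⊥ → ∀ x → x ∈ defended Fs
extinguished⇒defended {n} G Fs burnt x with x ∈? defended Fs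
... | yes x∈ = x∈
... | no x∉ = ⊥-elim (∉⊥ (subst (x ∈_) burnt (undefended-keeps-burning G Fs (x∈V n x) x∉)))

fireFightingInTime⇒n≤T*m : ∀ {n} (G : Graph n) m T → FireFightingInTime G m T → n ≤ T * m
fireFightingInTime⇒n≤T*m {n} G m T (Fs , sizes , burnt) = begin
  n               ≡⟨ ∣⊤∣≡n n ⟨
  ∣ ⊤ {n} ∣       ≤⟨ p⊆q⇒∣p∣≤∣q∣ {p = ⊤} (λ {x} _ → extinguished⇒defended G Fs burnt x) ⟩
  ∣ defended Fs ∣ ≤⟨ ∣defended∣≤T*m m Fs sizes ⟩
  T * m           ∎
  where open ≤-Reasoning

-- Decoding a graph from a prefix of the tape

symbolAt : List Sym → ℕ → Sym
symbolAt []       _       = blank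
symbolAt (x ∷ xs) zero    = x
symbolAt (x ∷ xs) (suc k) = symbolAt xs k

prefix : ℕ → List Sym → List Sym
prefix zero    _        = []
prefix (suc d) []       = blank ∷ prefix d []
prefix (suc d) (x ∷ xs) = x ∷ prefix d xs

prefix-blank : ∀ d → prefix d (blank ∷ []) ≡ prefix d []
prefix-blank zero    = refl
prefix-blank (suc d) = refl

symbolAt-prefix : ∀ {d k} xs → k < d → symbolAt (prefix d xs) k ≡ symbolAt xs k
symbolAt-prefix {suc d} {zero}  []       _         = refl
symbolAt-prefix {suc d} {suc k} []       (s≤s k<d) = symbolAt-prefix [] k<d
symbolAt-prefix {suc d} {zero}  (x ∷ xs) _         = refl
symbolAt-prefix {suc d} {suc k} (x ∷ xs) (s≤s k<d) = symbolAt-prefix xs k<d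

symbolAt-++ˡ : ∀ xs {ys k} → k < length xs → symbolAt (xs ++ ys) k ≡ symbolAt xs k
symbolAt-++ˡ (x ∷ xs) {k = zero}  _         = refl
symbolAt-++ˡ (x ∷ xs) {k = suc k} (s≤s k<l) = symbolAt-++ˡ xs k<l

symbolAt-++ʳ : ∀ xs {ys w} k → length xs ≡ w → symbolAt (xs ++ ys) (w + k) ≡ symbolAt ys k
symbolAt-++ʳ []       k refl = refl
symbolAt-++ʳ (x ∷ xs) k refl = symbolAt-++ʳ xs k refl

symbolAt-unary : ∀ n {rest} k →
  symbolAt (replicate n s1 ++ s0 ∷ rest) (suc n + k) ≡ symbolAt rest k
symbolAt-unary zero    k = refl
symbolAt-unary (suc n) k = symbolAt-unary n k

length-singletons : ∀ {A : Set} {k} (f : A → Sym) (h : Fin k → A) →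
  length (concatMap (λ a → f a ∷ []) (List.tabulate h)) ≡ k
length-singletons {k = zero}  f h = refl
length-singletons {k = suc k} f h = cong suc (length-singletons f (h ∘ Fin.suc))

symbolAt-singletons : ∀ {A : Set} {k} (f : A → Sym) (h : Fin k → A) i →
  symbolAt (concatMap (λ a → f a ∷ []) (List.tabulate h)) (toℕ i) ≡ f (h i)
symbolAt-singletons f h 0F          = refl
symbolAt-singletons f h (Fin.suc i) = symbolAt-singletons f (h ∘ Fin.suc) i

symbolAt-concatMap : ∀ {A : Set} {k w} (f : A → List Sym) (h : Fin k → A) →
  (∀ a → length (f a) ≡ w) → ∀ i (j : Fin w) →
  symbolAt (concatMap f (List.tabulate h)) (toℕ (combine i j)) ≡ symbolAt (f (h i)) (toℕ j)
symbolAt-concatMap {k = suc k} {w} f h len 0F j = begin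
  symbolAt (f (h 0F) ++ rest) (toℕ (j Fin.↑ˡ k * w))
    ≡⟨ cong (symbolAt (f (h 0F) ++ rest)) (toℕ-↑ˡ j (k * w)) ⟩
  symbolAt (f (h 0F) ++ rest) (toℕ j)
    ≡⟨ symbolAt-++ˡ (f (h 0F)) j<length ⟩
  symbolAt (f (h 0F)) (toℕ j)
    ∎
  where
  open ≡.≡-Reasoning
  rest : List Sym
  rest = concatMap f (List.tabulate (h ∘ Fin.suc))
  j<length : toℕ j < length (f (h 0F))
  j<length = subst (toℕ j <_) (≡.sym (len (h 0F))) (toℕ<n j)
symbolAt-concatMap {w = w} f h len (Fin.suc i) j = begin
  symbolAt (f (h 0F) ++ rest) (toℕ (w Fin.↑ʳ combine i j))
    ≡⟨ cong (symbolAt (f (h 0F) ++ rest)) (toℕ-↑ʳ w (combine i j)) ⟩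
  symbolAt (f (h 0F) ++ rest) (w + toℕ (combine i j))
    ≡⟨ symbolAt-++ʳ (f (h 0F)) _ (len (h 0F)) ⟩
  symbolAt rest (toℕ (combine i j))
    ≡⟨ symbolAt-concatMap f (h ∘ Fin.suc) len i j ⟩
  symbolAt (f (h (Fin.suc i))) (toℕ j)
    ∎
  where
  open ≡.≡-Reasoning
  rest : List Sym
  rest = concatMap f (List.tabulate (h ∘ Fin.suc))

adjIndex : ∀ n → Fin n → Fin n → ℕ
adjIndex n i j = suc n + toℕ (combine i j)

adjIndex< : ∀ n (i j : Fin n) → adjIndex n i j < suc n + n * n
adjIndex< n i j = +-monoʳ-< (suc n) (toℕ<n (combine i j))

symbolAt-encode : ∀ {n} (G : Graph n) i j → symbolAt (encode G) (adjIndex n i j) ≡ bit (adj G i j)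
symbolAt-encode {n} G i j = begin
  symbolAt (encode G) (adjIndex n i j)
    ≡⟨ symbolAt-unary n (toℕ (combine i j)) ⟩
  symbolAt (concatMap row (allFin n)) (toℕ (combine i j))
    ≡⟨ symbolAt-concatMap row id row-length i j ⟩
  symbolAt (row i) (toℕ j)
    ≡⟨ symbolAt-singletons (λ j → bit (adj G i j)) id j ⟩
  bit (adj G i j)
    ∎
  where
  open ≡.≡-Reasoning
  row : Fin n → List Sym
  row i = concatMap (λ j → bit (adj G i j) ∷ []) (allFin n)
  row-length : ∀ i → length (row i) ≡ n
  row-length i = length-singletons (λ j → bit (adj G i j)) id

leadingOnes : List Sym → ℕ
leadingOnes (s1 ∷ xs) = suc (leadingOnes xs)
leadingOnes _         = zero

leadingOnes-prefix : ∀ n d {rest} → leadingOnes (prefix d (replicate n s1 ++ s0 ∷ rest)) ≡ n ⊓ d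
leadingOnes-prefix zero    zero    = refl
leadingOnes-prefix zero    (suc d) = refl
leadingOnes-prefix (suc n) zero    = refl
leadingOnes-prefix (suc n) (suc d) = cong suc (leadingOnes-prefix n d)

isOne : Sym → Bool
isOne s1 = true
isOne _  = false

isOne-bit : ∀ b → isOne (bit b) ≡ b
isOne-bit true  = refl
isOne-bit false = refl

decodeAdj : ∀ n → List Sym → Fin n → Fin n → Bool
decodeAdj n p i j = isOne (symbolAt p (adjIndex n i j))

decodeAdj-prefix-encode : ∀ {n d} (G : Graph n) → suc n + n * n ≤ d →
  ∀ i j → decodeAdj n (prefix d (encode G)) i j ≡ adj G i j
decodeAdj-prefix-encode {n} {d} G long i j = begin
  isOne (symbolAt (prefix d (encode G)) (adjIndex n i j))
    ≡⟨ cong isOne (symbolAt-prefix (encode G) (<-≤-trans (adjIndex< n i j) long)) ⟩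
  isOne (symbolAt (encode G) (adjIndex n i j))
    ≡⟨ cong isOne (symbolAt-encode G i j) ⟩
  isOne (bit (adj G i j))
    ≡⟨ isOne-bit (adj G i j) ⟩
  adj G i j
    ∎
  where open ≡.≡-Reasoning

symmetrise : ∀ n → (Fin n → Fin n → Bool) → Graph n
symmetrise n a = record { adj = a′ ; sym = a′-sym ; irrefl = a′-irrefl }
  where
  a′ : Fin n → Fin n → Bool
  a′ i j = not (does (i Fin.≟ j)) ∧ (a i j ∧ a j i)
  a′-sym : ∀ i j → a′ i j ≡ a′ j i
  a′-sym i j = cong₂ (λ b c → not b ∧ c)
    (does-⇔ (mk⇔ ≡.sym ≡.sym) (i Fin.≟ j) (j Fin.≟ i)) (∧-comm (a i j) (a j i))
  a′-irrefl : ∀ i → a′ i i ≡ false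
  a′-irrefl i = cong (λ b → not b ∧ (a i i ∧ a i i)) (dec-true (i Fin.≟ i) refl)

adj-symmetrise : ∀ {n} (G : Graph n) {a} → (∀ i j → a i j ≡ adj G i j) →
  ∀ i j → adj (symmetrise n a) i j ≡ adj G i j
adj-symmetrise G {a} a≗ i j with i Fin.≟ j
... | yes refl = ≡.sym (irrefl G i)
... | no _     = trans (cong₂ _∧_ (a≗ i j) (trans (a≗ j i) (sym G j i))) (∧-idem (adj G i j))

-- Decision-tree machines

mapAction : ∀ {p q} → (Fin p → Fin q) → Action p → Action q
mapAction f (halt b)        = halt b
mapAction f (write q′ s mv) = write (f q′) s mv

mapAction-id : ∀ {p} (a : Action p) → mapAction id a ≡ a
mapAction-id (halt b)        = refl
mapAction-id (write q′ s mv) = refl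

mapAction-∘ : ∀ {p q r} (f : Fin q → Fin r) (g : Fin p → Fin q) a →
  mapAction f (mapAction g a) ≡ mapAction (f ∘ g) a
mapAction-∘ f g (halt b)        = refl
mapAction-∘ f g (write q′ s mv) = refl

symbolIndex : Sym → Fin 3
symbolIndex s0    = 0F
symbolIndex s1    = 1F
symbolIndex blank = 2F

indexSymbol : Fin 3 → Sym
indexSymbol 0F = s0
indexSymbol 1F = s1
indexSymbol 2F = blank

indexSymbol-symbolIndex : ∀ s → indexSymbol (symbolIndex s) ≡ s
indexSymbol-symbolIndex s0    = refl
indexSymbol-symbolIndex s1    = refl
indexSymbol-symbolIndex blank = refl

-- States of a complete ternary decision tree of depth d: the root 0F, and state i of the
-- subtree below symbol s is child d s i. A state remembers exactly the symbols read so far.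
treeSize : ℕ → ℕ
treeSize zero    = 1
treeSize (suc d) = suc (3 * treeSize d)

root : ∀ d → Fin (treeSize d)
root zero    = 0F
root (suc d) = 0F

child : ∀ d → Sym → Fin (treeSize d) → Fin (treeSize (suc d))
child d s i = Fin.suc (combine (symbolIndex s) i)

treeδ : ∀ d → (List Sym → Bool) → Fin (treeSize d) → Sym → Action (treeSize d)
subtreeδ : ∀ d → (List Sym → Bool) → Fin 3 × Fin (treeSize d) → Sym → Action (treeSize (suc d))

treeδ zero    f _           _ = halt (f [])
treeδ (suc d) f 0F          h = write (child d h (root d)) h R
treeδ (suc d) f (Fin.suc i) h = subtreeδ d f (remQuot (treeSize d) i) h

subtreeδ d f (s , i) h =
  mapAction (child d (indexSymbol s)) (treeδ d (f ∘ (indexSymbol s ∷_)) i h)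

treeδ-child : ∀ d f s i h →
  treeδ (suc d) f (child d s i) h ≡ mapAction (child d s) (treeδ d (f ∘ (s ∷_)) i h)
treeδ-child d f s i h = trans
  (cong (λ si → subtreeδ d f si h) (remQuot-combine (symbolIndex s) i))
  (cong (λ s′ → mapAction (child d s′) (treeδ d (f ∘ (s′ ∷_)) i h)) (indexSymbol-symbolIndex s))

Implements : (M : TM) {k : ℕ} → (Fin k → Fin (states M)) → (Fin k → Sym → Action k) → Set
Implements M ι δ′ = ∀ i h → δ M (ι i) h ≡ mapAction ι (δ′ i h)

implements-child : ∀ {M d f ι} → Implements M ι (treeδ (suc d) f) →
  ∀ s → Implements M (ι ∘ child d s) (treeδ d (f ∘ (s ∷_)))
implements-child {M} {d} {f} {ι} implements s i h = begin
  δ M (ι (child d s i)) h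
    ≡⟨ implements (child d s i) h ⟩
  mapAction ι (treeδ (suc d) f (child d s i) h)
    ≡⟨ cong (mapAction ι) (treeδ-child d f s i h) ⟩
  mapAction ι (mapAction (child d s) (treeδ d (f ∘ (s ∷_)) i h))
    ≡⟨ mapAction-∘ ι (child d s) _ ⟩
  mapAction (ι ∘ child d s) (treeδ d (f ∘ (s ∷_)) i h)
    ∎
  where open ≡.≡-Reasoning

run-tree : ∀ {M} d {f ι} → Implements M ι (treeδ d f) →
  ∀ l h r → run M (suc d) (conf (ι (root d)) l h r) ≡ halted (f (prefix d (h ∷ r)))
run-tree zero implements l h r rewrite implements (root zero) h = refl
run-tree {M} (suc d) {f} implements l h []
  rewrite implements (root (suc d)) h =
  trans (run-tree d (implements-child {M} implements h) (h ∷ l) blank [])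
        (cong (λ xs → halted (f (h ∷ xs))) (prefix-blank d))
run-tree {M} (suc d) implements l h (x ∷ r)
  rewrite implements (root (suc d)) h =
  run-tree d (implements-child {M} implements h) (h ∷ l) x r

prefixDecider : ∀ d (f : List Sym → Bool) →
  Σ TM λ M → ∀ xs → run M (suc d) (initConf M xs) ≡ halted (f (prefix d xs))
prefixDecider d f = M , runs
  where
  M : TM
  M = record { states = treeSize d ; start = root d ; δ = treeδ d f }
  implements : Implements M id (treeδ d f)
  implements i h = ≡.sym (mapAction-id (treeδ d f i h))
  runs : ∀ xs → run M (suc d) (initConf M xs) ≡ halted (f (prefix d xs))
  runs []       = trans (run-tree d implements [] blank [])
                        (cong (λ xs → halted (f xs)) (prefix-blank d))
  runs (x ∷ xs) = run-tree d implements [] x xs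

-- Properties of boundedly many vertices are decidable in constant time

does-reflects : ∀ {A : Set} (a? : Dec A) → (does a? ≡ true → A) × (A → does a? ≡ true)
does-reflects (yes a) = (λ _ → a) , (λ _ → refl)
does-reflects (no ¬a) = (λ ()) , (λ a → ⊥-elim (¬a a))

module BoundedGraphProperty
  (P : ∀ {n} → Graph n → Set)
  (P? : ∀ {n} (G : Graph n) → Dec (P G))
  (P-cong : ∀ {n} {G H : Graph n} → (∀ i j → adj G i j ≡ adj H i j) → P G → P H)
  (K : ℕ)
  (P⇒n≤K : ∀ {n} (G : Graph n) → P G → n ≤ K)
  where

  readLength : ℕ
  readLength = suc K + K * K

  decideWithin : ℕ → List Sym → Bool
  decideWithin n p = does (n ≤? K) ∧ does (P? (symmetrise n (decodeAdj n p)))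

  decideWithin-small : ∀ {k} p → k ≤ K →
    decideWithin k p ≡ does (P? (symmetrise k (decodeAdj k p)))
  decideWithin-small {k} p k≤K rewrite dec-true (k ≤? K) k≤K = refl

  decideWithin-large : ∀ {k} p → ¬ k ≤ K → decideWithin k p ≡ false
  decideWithin-large {k} p k≰K rewrite dec-false (k ≤? K) k≰K = refl

  decodeAndDecide : List Sym → Bool
  decodeAndDecide p = decideWithin (leadingOnes p) p

  tape : ∀ {n} → Graph n → List Sym
  tape G = prefix readLength (encode G)

  decodeAndDecide-small : ∀ {n} (G : Graph n) → n ≤ K → decodeAndDecide (tape G) ≡ does (P? G)
  decodeAndDecide-small {n} G n≤K = begin
    decideWithin (leadingOnes (tape G)) (tape G) ≡⟨ cong (λ k → decideWithin k (tape G)) leadingOnes≡n ⟩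
    decideWithin n (tape G)                      ≡⟨ decideWithin-small (tape G) n≤K ⟩
    does (P? G′)                                 ≡⟨ does-⇔ (mk⇔ (P-cong G′≗G) (P-cong G≗G′)) (P? G′) (P? G) ⟩
    does (P? G)                                  ∎
    where
    open ≡.≡-Reasoning
    leadingOnes≡n : leadingOnes (tape G) ≡ n
    leadingOnes≡n = trans (leadingOnes-prefix n readLength)
      (m≤n⇒m⊓n≡m (≤-trans n≤K (≤-trans (n≤1+n K) (m≤m+n (suc K) (K * K)))))
    G′ : Graph n
    G′ = symmetrise n (decodeAdj n (tape G))
    G′≗G : ∀ i j → adj G′ i j ≡ adj G i j
    G′≗G = adj-symmetrise G (decodeAdj-prefix-encode G (+-mono-≤ (s≤s n≤K) (*-mono-≤ n≤K n≤K)))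
    G≗G′ : ∀ i j → adj G i j ≡ adj G′ i j
    G≗G′ i j = ≡.sym (G′≗G i j)

  decodeAndDecide-large : ∀ {n} (G : Graph n) → ¬ n ≤ K → decodeAndDecide (tape G) ≡ does (P? G)
  decodeAndDecide-large {n} G n≰K =
    trans (decideWithin-large (tape G) leadingOnes≰K)
          (≡.sym (dec-false (P? G) (n≰K ∘ P⇒n≤K G)))
    where
    leadingOnes≰K : ¬ leadingOnes (tape G) ≤ K
    leadingOnes≰K = <⇒≱ (subst (K <_) (≡.sym (leadingOnes-prefix n readLength))
      (⊓-glb (≰⇒> n≰K) (s≤s (m≤m+n K (K * K)))))

  decodeAndDecide-encode : ∀ {n} (G : Graph n) → decodeAndDecide (tape G) ≡ does (P? G)
  decodeAndDecide-encode {n} G with n ≤? K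
  ... | yes n≤K = decodeAndDecide-small G n≤K
  ... | no n≰K  = decodeAndDecide-large G n≰K

  polyTimeDecider : Σ TM λ M → PolyTimeDecides M P
  polyTimeDecider = M , suc readLength , 0 , λ n G →
    suc readLength , does (P? G) , ≤-reflexive (≡.sym (*-identityʳ (suc readLength))) ,
    trans (runs (encode G)) (cong halted (decodeAndDecide-encode G)) , does-reflects (P? G)
    where
    open Σ (prefixDecider readLength decodeAndDecide) renaming (proj₁ to M; proj₂ to runs)

theorem9 : (T m : ℕ) → 0 < T → 0 < m →
    Σ TM λ M → PolyTimeDecides M (λ G → FireFightingInTime G m T)
theorem9 T m _ _ = BoundedGraphProperty.polyTimeDecider
  (λ G → FireFightingInTime G m T)
  (λ G → fireFightingInTime? G m T)
  (λ adj≗ → fireFightingInTime-cong adj≗)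
  (T * m)
  (λ G → fireFightingInTime⇒n≤T*m G m T)
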